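{- Let $g(m)$ denote the number of unit Fubini rankings of length $m$. Then $g(1)=1$, $g(2)=3$, and for every $n\ge 2$, $$g(n+1)=(n+1)\,g(n)+\binom{n+1}{2}g(n-1).$$
   Context: $[n]=\{1,\ldots,n\}$. Parking process: $\alpha=(a_1,\ldots,a_n)\in[n]^n$ encodes preferences of cars $1,\ldots,n$ arriving in order at a one-way street with spots $1,\ldots,n$; car $i$ parks in spot $a_i$ if free, otherwise in the first free spot after $a_i$, if any. $\alpha$ is a parking function if all cars park. A unit interval parking function is a parking function in which each car $i$ parks in spot $a_i$ or $a_i+1$. A Fubini ranking is a tuple $(r_1,\ldots,r_n)\in[n]^n$ with $r_i=1+|\{j:r_j<r_i\}|$ for all $i$. A unit Fubini ranking is a tuple that is both a Fubini ranking and a unit interval parking function. -}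

module Defs where

open import Data.Nat using (ℕ; zero; suc; _+_; _≤_; _<_; _≤?_; _<?_; _≟_)
open import Data.Nat.Combinatorics using (_C_)
open import Data.Bool using (Bool; true; false; if_then_else_)
open import Data.List using (List; []; _∷_; length; filter; map; concatMap; zip; upTo)
open import Data.List.Membership.DecPropositional _≟_ using (_∈?_)
open import Data.List.Relation.Unary.All using (All)
open import Data.Maybe using (Maybe; just; nothing)
open import Data.Product using (_×_; _,_; ∃)
open import Data.Sum using (_⊎_)
open import Relation.Nullary using (Dec; yes; no; ¬_)
open import Relation.Binary.PropositionalEquality using (_≡_; refl)

open import Relation.Nullary.Decidable using (_⊎-dec_; _×-dec_)
open import Data.List.Relation.Unary.All using (all?)

-- Preference lists are represented as lists of natural numbers (1-based spots).

range1 : ℕ → List ℕ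
range1 n = map suc (upTo n)

tuples : ℕ → ℕ → List (List ℕ)
tuples n zero    = [] ∷ []
tuples n (suc k) = concatMap (λ a → map (a ∷_) (tuples n k)) (range1 n)

words : ℕ → List (List ℕ)
words n = tuples n n

-- first free spot among a, a+1, …, n (fuel = number of spots still to try)
firstFree : (n : ℕ) → (occupied : List ℕ) → (a : ℕ) → (fuel : ℕ) → Maybe ℕ
firstFree n occ a zero = nothing
firstFree n occ a (suc fuel) with a ≤? n
... | no _ = nothing
... | yes _ with a ∈? occ
...   | yes _ = firstFree n occ (suc a) fuel
...   | no _  = just a

-- Parking process on a street with spots 1..n: cars arrive in order;
-- returns the list of spots where the cars park (in car order) if all cars park.
parkFrom : (n : ℕ) → (occupied : List ℕ) → List ℕ → Maybe (List ℕ)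
parkFrom n occ [] = just []
parkFrom n occ (a ∷ as) with firstFree n occ a n
... | nothing = nothing
... | just s with parkFrom n (s ∷ occ) as
...   | nothing = nothing
...   | just ss = just (s ∷ ss)

outcome : (n : ℕ) → List ℕ → Maybe (List ℕ)
outcome n α = parkFrom n [] α

IsParkingFunction : (n : ℕ) → List ℕ → Set
IsParkingFunction n α = ∃ λ s → outcome n α ≡ just s

ParksNear : ℕ × ℕ → Set
ParksNear (a , s) = (s ≡ a) ⊎ (s ≡ suc a)

IsUnitIntervalPF : (n : ℕ) → List ℕ → Set
IsUnitIntervalPF n α = ∃ λ s → (outcome n α ≡ just s) × All ParksNear (zip α s)

countLess : ℕ → List ℕ → ℕ
countLess x r = length (filter (λ y → y <? x) r)

IsFubiniRanking : List ℕ → Set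
IsFubiniRanking r = All (λ x → x ≡ suc (countLess x r)) r

IsUnitFubini : (n : ℕ) → List ℕ → Set
IsUnitFubini n r = IsFubiniRanking r × IsUnitIntervalPF n r

isUnitFubini? : (n : ℕ) → (r : List ℕ) → Dec (IsUnitFubini n r)
isUnitFubini? n r = fub? r ×-dec uipf? (outcome n r)
  where
  fub? : (r : List ℕ) → Dec (IsFubiniRanking r)
  fub? r = all? (λ x → x ≟ suc (countLess x r)) r
  near? : (p : ℕ × ℕ) → Dec (ParksNear p)
  near? (a , s) = (s ≟ a) ⊎-dec (s ≟ suc a)
  uipf? : (m : Maybe (List ℕ)) → Dec (∃ λ s → (m ≡ just s) × All ParksNear (zip r s))
  uipf? nothing = no λ { (_ , () , _) }
  uipf? (just s) with all? near? (zip r s)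
  ... | yes p = yes (s , refl , p)
  ... | no ¬p = no λ { (.s , refl , p) → ¬p p }

g : ℕ → ℕ
g m = length (filter (isUnitFubini? m) (words m))

-- A unit Fubini ranking is the same as a Fubini ranking in which every value occurs at most
-- twice. In a unit interval parking function every spot receives one car and a car preferring v
-- parks in v or v + 1, so at most two cars prefer v. Conversely, in a Fubini ranking a value v used
-- twice is followed by the gap v + 1, so the first car preferring v parks in v and the second in
-- v + 1. Removing the top block of such a ranking of length n + 1 leaves one of length n (the top
-- value n + 1 occurs once, in any of n + 1 positions) or of length n - 1 (the top value n occurs
-- twice, in any of C(n + 1, 2) pairs of positions), which is the recurrence.

{-# OPTIONS --safe #-}
module Submission where

open import Defs
open import Data.Bool using (Bool; true; false; if_then_else_; _∧_; _∨_; T)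
open import Data.Bool.Properties using (T-∧; T-∨; ∧-zeroʳ)
open import Data.Empty using (⊥; ⊥-elim)
open import Data.List using (List; []; _∷_; length; map; filter; concatMap; _++_; _∷ʳ_; upTo; null; zip)
open import Data.List.Extrema.Nat using (max; argmax-all; xs≤max; ⊥≤max)
open import Data.List.Membership.Propositional using (_∈_; _∉_)
open import Data.List.Properties using (upTo-∷ʳ; map-++; map-cong; filter-accept; filter-reject; length-filter)
open import Data.List.Relation.Unary.All as All using (All; []; _∷_)
open import Data.List.Relation.Unary.All.Properties using (∷ʳ⁺; concat⁺; map⁺)
open import Data.List.Relation.Unary.Any using (here; there)
open import Data.Maybe using (just)
open import Data.Nat
open import Data.Nat.Combinatorics using (_C_; nCn≡1; nC1≡n; nCk+nC[k+1]≡[n+1]C[k+1])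
open import Data.Nat.ListAction using (sum)
open import Data.Nat.ListAction.Properties using (sum-++)
open import Data.Nat.Properties
open import Data.List.Membership.DecPropositional _≟_ using (_∈?_)
open import Algebra.Properties.CommutativeSemigroup +-commutativeSemigroup using (x∙yz≈y∙xz)
open import Data.Product using (_×_; _,_; proj₁; proj₂; Σ-syntax)
open import Data.Sum as Sum using (_⊎_; inj₁; inj₂; [_,_])
open import Function using (_∘_; id; _⇔_; mk⇔; Equivalence; case_of_)
open import Relation.Binary.PropositionalEquality hiding ([_])
open import Relation.Nullary using (yes; no; ¬_)
open import Relation.Unary using (Decidable)

private variable
  A B : Set

count : (A → Bool) → List A → ℕ
count p []       = 0
count p (x ∷ xs) = if p x then suc (count p xs) else count p xs

count-++ : ∀ (p : A → Bool) xs ys → count p (xs ++ ys) ≡ count p xs + count p ys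
count-++ p []       ys = refl
count-++ p (x ∷ xs) ys with p x
... | true  = cong suc (count-++ p xs ys)
... | false = count-++ p xs ys

count-map : ∀ (p : B → Bool) (f : A → B) xs → count p (map f xs) ≡ count (p ∘ f) xs
count-map p f []       = refl
count-map p f (x ∷ xs) with p (f x)
... | true  = cong suc (count-map p f xs)
... | false = count-map p f xs

count-cong : ∀ {p q : A → Bool} → (∀ x → p x ≡ q x) → ∀ xs → count p xs ≡ count q xs
count-cong         p≗q []       = refl
count-cong {q = q} p≗q (x ∷ xs) rewrite p≗q x with q x
... | true  = cong suc (count-cong p≗q xs)
... | false = count-cong p≗q xs

count-none : ∀ {p : A → Bool} {xs} → All (λ x → p x ≡ false) xs → count p xs ≡ 0
count-none []             = refl
count-none (px≡false ∷ h) rewrite px≡false = count-none h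

count-∨ : ∀ (p q : A → Bool) → (∀ x → T (p x) → T (q x) → ⊥) →
          ∀ xs → count (λ x → p x ∨ q x) xs ≡ count p xs + count q xs
count-∨ p q disjoint []       = refl
count-∨ p q disjoint (x ∷ xs) with p x in px | q x in qx
... | true  | true  = ⊥-elim (disjoint x (subst T (sym px) _) (subst T (sym qx) _))
... | true  | false = cong suc (count-∨ p q disjoint xs)
... | false | true  = trans (cong suc (count-∨ p q disjoint xs)) (sym (+-suc _ _))
... | false | false = count-∨ p q disjoint xs

count-concatMap : ∀ (p : B → Bool) (h : A → List B) xs →
                  count p (concatMap h xs) ≡ sum (map (count p ∘ h) xs)
count-concatMap p h []       = refl
count-concatMap p h (x ∷ xs) =
  trans (count-++ p (h x) (concatMap h xs)) (cong (count p (h x) +_) (count-concatMap p h xs))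

sum-map-*ˡ : ∀ c (f : A → ℕ) xs → sum (map (λ x → c * f x) xs) ≡ c * sum (map f xs)
sum-map-*ˡ c f []       = sym (*-zeroʳ c)
sum-map-*ˡ c f (x ∷ xs) =
  trans (cong (c * f x +_) (sum-map-*ˡ c f xs)) (sym (*-distribˡ-+ c (f x) _))

sum-map-++ : ∀ (f : A → ℕ) xs ys → sum (map f (xs ++ ys)) ≡ sum (map f xs) + sum (map f ys)
sum-map-++ f xs ys = trans (cong sum (map-++ f xs ys)) (sum-++ (map f xs) (map f ys))

occ : ℕ → List ℕ → ℕ
occ m []       = 0
occ m (x ∷ xs) with x ≟ m
... | yes _ = suc (occ m xs)
... | no  _ = occ m xs

erase : ℕ → List ℕ → List ℕ
erase m []       = []
erase m (x ∷ xs) with x ≟ m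
... | yes _ = erase m xs
... | no  _ = x ∷ erase m xs

occ-≡ : ∀ m xs → occ m (m ∷ xs) ≡ suc (occ m xs)
occ-≡ m xs with m ≟ m
... | yes _   = refl
... | no  m≢m = ⊥-elim (m≢m refl)

occ-≢ : ∀ {m x} xs → x ≢ m → occ m (x ∷ xs) ≡ occ m xs
occ-≢ {m} {x} xs x≢m with x ≟ m
... | yes x≡m = ⊥-elim (x≢m x≡m)
... | no  _   = refl

erase-≡ : ∀ m xs → erase m (m ∷ xs) ≡ erase m xs
erase-≡ m xs with m ≟ m
... | yes _   = refl
... | no  m≢m = ⊥-elim (m≢m refl)

erase-≢ : ∀ {m x} xs → x ≢ m → erase m (x ∷ xs) ≡ x ∷ erase m xs
erase-≢ {m} {x} xs x≢m with x ≟ m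
... | yes x≡m = ⊥-elim (x≢m x≡m)
... | no  _   = refl

occ-++ : ∀ m xs ys → occ m (xs ++ ys) ≡ occ m xs + occ m ys
occ-++ m []       ys = refl
occ-++ m (x ∷ xs) ys with x ≟ m
... | yes _ = cong suc (occ-++ m xs ys)
... | no  _ = occ-++ m xs ys

occ-≤-occ-∷ : ∀ m x xs → occ m xs ≤ occ m (x ∷ xs)
occ-≤-occ-∷ m x xs with x ≟ m
... | yes _ = n≤1+n _
... | no  _ = ≤-refl

occ-≤-length : ∀ m xs → occ m xs ≤ length xs
occ-≤-length m []       = z≤n
occ-≤-length m (x ∷ xs) with x ≟ m
... | yes _ = s≤s (occ-≤-length m xs)
... | no  _ = m≤n⇒m≤1+n (occ-≤-length m xs)

occ-> : ∀ {M} m xs → All (_≤ M) xs → M < m → occ m xs ≡ 0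
occ-> m []       []         M<m = refl
occ-> m (x ∷ xs) (x≤M ∷ h) M<m with x ≟ m
... | yes refl = ⊥-elim (<⇒≱ M<m x≤M)
... | no  _    = occ-> m xs h M<m

All-occ : ∀ {P : ℕ → Set} m xs → All P xs → 1 ≤ occ m xs → P m
All-occ m (x ∷ xs) (px ∷ h) occ≥1 with x ≟ m
... | yes refl = px
... | no  _    = All-occ m xs h occ≥1

occ-∈ : ∀ {x xs} → x ∈ xs → 1 ≤ occ x xs
occ-∈ {x} {.x ∷ xs} (here refl) = subst (1 ≤_) (sym (occ-≡ x xs)) (s≤s z≤n)
occ-∈ {x} {y ∷ xs}  (there x∈)  = ≤-trans (occ-∈ x∈) (occ-≤-occ-∷ x y xs)

occ-erase-≢ : ∀ {m m'} xs → m ≢ m' → occ m (erase m' xs) ≡ occ m xs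
occ-erase-≢         []       m≢m' = refl
occ-erase-≢ {m} {m'} (x ∷ xs) m≢m' with x ≟ m'
... | yes refl = trans (occ-erase-≢ xs m≢m') (sym (occ-≢ xs (m≢m' ∘ sym)))
... | no  _ with x ≟ m
...   | yes _ = cong suc (occ-erase-≢ xs m≢m')
...   | no  _ = occ-erase-≢ xs m≢m'

occ-erase-≤ : ∀ v m xs → occ v (erase m xs) ≤ occ v xs
occ-erase-≤ v m []       = z≤n
occ-erase-≤ v m (x ∷ xs) with x ≟ m
... | yes _ = ≤-trans (occ-erase-≤ v m xs) (occ-≤-occ-∷ v x xs)
... | no  _ with x ≟ v
...   | yes _ = s≤s (occ-erase-≤ v m xs)
...   | no  _ = occ-erase-≤ v m xs

length-erase : ∀ m xs → length xs ≡ occ m xs + length (erase m xs)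
length-erase m []       = refl
length-erase m (x ∷ xs) with x ≟ m
... | yes _ = cong suc (length-erase m xs)
... | no  _ = trans (cong suc (length-erase m xs)) (sym (+-suc _ _))

All-erase⁺ : ∀ {P : ℕ → Set} m {xs} → All P xs → All P (erase m xs)
All-erase⁺ m []                       = []
All-erase⁺ m {x ∷ xs} (px ∷ h) with x ≟ m
... | yes _ = All-erase⁺ m h
... | no  _ = px ∷ All-erase⁺ m h

All-erase⁻ : ∀ {P : ℕ → Set} m xs → P m → All P (erase m xs) → All P xs
All-erase⁻ m []       pm h = []
All-erase⁻ m (x ∷ xs) pm h with x ≟ m
All-erase⁻ m (x ∷ xs) pm h        | yes refl = pm ∷ All-erase⁻ m xs pm h
All-erase⁻ m (x ∷ xs) pm (px ∷ h) | no  _    = px ∷ All-erase⁻ m xs pm h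

erase-max : ∀ M {xs} → All (_≤ M) xs → All (_< M) (erase M xs)
erase-max M []                  = []
erase-max M {x ∷ xs} (x≤M ∷ h) with x ≟ M
... | yes _   = erase-max M h
... | no  x≢M = ≤∧≢⇒< x≤M x≢M ∷ erase-max M h

zeroAt : ℕ → (ℕ → ℕ) → ℕ → ℕ
zeroAt m f a with a ≟ m
... | yes _ = 0
... | no  _ = f a

zeroAt-≡ : ∀ m (f : ℕ → ℕ) → zeroAt m f m ≡ 0
zeroAt-≡ m f with m ≟ m
... | yes _   = refl
... | no  m≢m = ⊥-elim (m≢m refl)

zeroAt-≢ : ∀ {m a} (f : ℕ → ℕ) → a ≢ m → zeroAt m f a ≡ f a
zeroAt-≢ {m} {a} f a≢m with a ≟ m
... | yes a≡m = ⊥-elim (a≢m a≡m)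
... | no  _   = refl

zeroAt-cong : ∀ m {f h : ℕ → ℕ} → (∀ a → a ≢ m → f a ≡ h a) → ∀ a → zeroAt m f a ≡ zeroAt m h a
zeroAt-cong m f≗h a with a ≟ m
... | yes _   = refl
... | no  a≢m = f≗h a a≢m

zeroAt-*ˡ : ∀ m c (f : ℕ → ℕ) a → zeroAt m (λ x → c * f x) a ≡ c * zeroAt m f a
zeroAt-*ˡ m c f a with a ≟ m
... | yes _ = sym (*-zeroʳ c)
... | no  _ = refl

sum-map-zeroAt : ∀ m (f : ℕ → ℕ) as → sum (map f as) ≡ occ m as * f m + sum (map (zeroAt m f) as)
sum-map-zeroAt m f []       = refl
sum-map-zeroAt m f (a ∷ as) with a ≟ m
... | yes refl = trans (cong (f a +_) (sum-map-zeroAt a f as)) (sym (+-assoc (f a) _ _))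
... | no  _    = trans (cong (f a +_) (sum-map-zeroAt m f as)) (x∙yz≈y∙xz (f a) (occ m as * f m) _)

range1-∷ʳ : ∀ N → range1 (suc N) ≡ range1 N ∷ʳ suc N
range1-∷ʳ N = trans (cong (map suc) (sym (upTo-∷ʳ N))) (map-++ suc (upTo N) (N ∷ []))

InRange : ℕ → ℕ → Set
InRange N a = 1 ≤ a × a ≤ N

range1-inRange : ∀ N → All (InRange N) (range1 N)
range1-inRange zero    = []
range1-inRange (suc N) = subst (All (InRange (suc N))) (sym (range1-∷ʳ N))
  (∷ʳ⁺ (All.map (λ (1≤a , a≤N) → 1≤a , m≤n⇒m≤1+n a≤N) (range1-inRange N)) (s≤s z≤n , ≤-refl))

IsTuple : ℕ → ℕ → List ℕ → Set
IsTuple N L t = length t ≡ L × All (InRange N) t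

tuples-isTuple : ∀ N L → All (IsTuple N L) (tuples N L)
tuples-isTuple N zero    = (refl , []) ∷ []
tuples-isTuple N (suc L) = concat⁺ (map⁺ (All.map
  (λ a∈[N] → map⁺ (All.map (λ (len , t∈[N]) → cong suc len , a∈[N] ∷ t∈[N]) (tuples-isTuple N L)))
  (range1-inRange N)))

occ-range1 : ∀ {m N} → InRange N m → occ m (range1 N) ≡ 1
occ-range1 {N = zero}  (s≤s _ , ())
occ-range1 {m} {suc N} (1≤m , m≤1+N) = begin
  occ m (range1 (suc N))                 ≡⟨ cong (occ m) (range1-∷ʳ N) ⟩
  occ m (range1 N ∷ʳ suc N)               ≡⟨ occ-++ m (range1 N) _ ⟩
  occ m (range1 N) + occ m (suc N ∷ [])   ≡⟨ last-or-earlier (m≤n⇒m<n∨m≡n m≤1+N) ⟩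
  1                                       ∎
  where
  open ≡-Reasoning
  last-or-earlier : m < suc N ⊎ m ≡ suc N → occ m (range1 N) + occ m (suc N ∷ []) ≡ 1
  last-or-earlier (inj₁ m≤N)  = cong₂ _+_ (occ-range1 (1≤m , ≤-pred m≤N)) (occ-≢ [] λ 1+N≡m → <-irrefl (sym 1+N≡m) m≤N)
  last-or-earlier (inj₂ refl) = cong₂ _+_ (occ-> m (range1 N) (All.map proj₂ (range1-inRange N)) ≤-refl) (occ-≡ m [])

count-tuples-suc : ∀ (p : List ℕ → Bool) N L →
  count p (tuples N (suc L)) ≡ sum (map (λ a → count (p ∘ (a ∷_)) (tuples N L)) (range1 N))
count-tuples-suc p N L = trans (count-concatMap p (λ a → map (a ∷_) (tuples N L)) (range1 N))
                               (cong sum (map-cong (λ a → count-map p (a ∷_) (tuples N L)) (range1 N)))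

sum-map-range1-≤ : ∀ (f : ℕ → ℕ) {M N} → M ≤ N → (∀ a → M < a → f a ≡ 0) →
                   sum (map f (range1 N)) ≡ sum (map f (range1 M))
sum-map-range1-≤ f {M} {N} M≤N f>M≡0 with m≤n⇒m<n∨m≡n M≤N
... | inj₂ refl = refl
sum-map-range1-≤ f {M} {suc N} M≤N f>M≡0 | inj₁ M<1+N = begin
  sum (map f (range1 (suc N)))              ≡⟨ cong (sum ∘ map f) (range1-∷ʳ N) ⟩
  sum (map f (range1 N ∷ʳ suc N))           ≡⟨ sum-map-++ f (range1 N) _ ⟩
  sum (map f (range1 N)) + (f (suc N) + 0)  ≡⟨ cong₂ _+_ (sum-map-range1-≤ f (≤-pred M<1+N) f>M≡0)
                                                         (cong (_+ 0) (f>M≡0 (suc N) M<1+N)) ⟩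
  sum (map f (range1 M)) + 0                ≡⟨ +-identityʳ _ ⟩
  sum (map f (range1 M))                    ∎
  where open ≡-Reasoning

count-tuples-bounded : ∀ {M N} (p : List ℕ → Bool) → M ≤ N → (∀ t → T (p t) → All (_≤ M) t) →
                       ∀ k → count p (tuples N k) ≡ count p (tuples M k)
count-tuples-bounded p M≤N bounded zero    = refl
count-tuples-bounded {M} {N} p M≤N bounded (suc k) = begin
  count p (tuples N (suc k))
    ≡⟨ count-tuples-suc p N k ⟩
  sum (map (λ a → count (p ∘ (a ∷_)) (tuples N k)) (range1 N))
    ≡⟨ cong sum (map-cong (λ a → count-tuples-bounded (p ∘ (a ∷_)) M≤N (λ t → tail ∘ bounded (a ∷ t)) k) (range1 N)) ⟩
  sum (map (λ a → count (p ∘ (a ∷_)) (tuples M k)) (range1 N))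
    ≡⟨ sum-map-range1-≤ _ M≤N (λ a M<a → count-none (All.universal (head-too-big a M<a) (tuples M k))) ⟩
  sum (map (λ a → count (p ∘ (a ∷_)) (tuples M k)) (range1 M))
    ≡⟨ count-tuples-suc p M k ⟨
  count p (tuples M (suc k))
    ∎
  where
  open ≡-Reasoning
  tail : ∀ {a t} → All (_≤ M) (a ∷ t) → All (_≤ M) t
  tail (_ ∷ h) = h
  head-too-big : ∀ a → M < a → ∀ t → p (a ∷ t) ≡ false
  head-too-big a M<a t with p (a ∷ t) in pat
  ... | false = refl
  ... | true with bounded (a ∷ t) (subst T (sym pat) _)
  ...   | a≤M ∷ _ = ⊥-elim (<⇒≱ M<a a≤M)

avoiding : ℕ → (List ℕ → Bool) → List ℕ → Bool
avoiding m q t = (occ m t ≡ᵇ 0) ∧ q t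

withOcc : ℕ → ℕ → (List ℕ → Bool) → List ℕ → Bool
withOcc m j q t = (occ m t ≡ᵇ j) ∧ q (erase m t)

module Positions (m N : ℕ) (m∈[N] : InRange N m) where

  count-avoiding-suc : ∀ q k → count (avoiding m q) (tuples N (suc k))
    ≡ sum (map (zeroAt m (λ a → count (avoiding m (q ∘ (a ∷_))) (tuples N k))) (range1 N))
  count-avoiding-suc q k = trans (count-tuples-suc (avoiding m q) N k) (cong sum (map-cong by-head (range1 N)))
    where
    h : ℕ → ℕ
    h a = count (avoiding m (q ∘ (a ∷_))) (tuples N k)
    by-head : ∀ a → count (avoiding m q ∘ (a ∷_)) (tuples N k) ≡ zeroAt m h a
    by-head a = case a ≟ m of λ where
      (yes refl) → trans (count-none (All.universal (λ t → cong (λ o → (o ≡ᵇ 0) ∧ q (a ∷ t)) (occ-≡ a t)) (tuples N k)))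
                         (sym (zeroAt-≡ a h))
      (no a≢m)   → trans (count-cong (λ t → cong (λ o → (o ≡ᵇ 0) ∧ q (a ∷ t)) (occ-≢ t a≢m)) (tuples N k))
                         (sym (zeroAt-≢ h a≢m))

  count-withOcc-suc : ∀ j q L → count (withOcc m j q) (tuples N (suc L))
    ≡ count (λ t → (suc (occ m t) ≡ᵇ j) ∧ q (erase m t)) (tuples N L)
      + sum (map (zeroAt m (λ a → count (withOcc m j (q ∘ (a ∷_))) (tuples N L))) (range1 N))
  count-withOcc-suc j q L = begin
    count (withOcc m j q) (tuples N (suc L))
      ≡⟨ count-tuples-suc _ N L ⟩
    sum (map by-head (range1 N))
      ≡⟨ sum-map-zeroAt m by-head (range1 N) ⟩
    occ m (range1 N) * by-head m + sum (map (zeroAt m by-head) (range1 N))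
      ≡⟨ cong₂ _+_ (trans (cong (_* by-head m) (occ-range1 m∈[N])) (+-identityʳ _))
                   (cong sum (map-cong (zeroAt-cong m head-≢) (range1 N))) ⟩
    by-head m + rest
      ≡⟨ cong (_+ rest) head-≡ ⟩
    count (λ t → (suc (occ m t) ≡ᵇ j) ∧ q (erase m t)) (tuples N L) + rest
      ∎
    where
    open ≡-Reasoning
    rest : ℕ
    rest = sum (map (zeroAt m (λ a → count (withOcc m j (q ∘ (a ∷_))) (tuples N L))) (range1 N))
    by-head : ℕ → ℕ
    by-head a = count (withOcc m j q ∘ (a ∷_)) (tuples N L)
    head-≡ : by-head m ≡ count (λ t → (suc (occ m t) ≡ᵇ j) ∧ q (erase m t)) (tuples N L)
    head-≡ = count-cong (λ t → cong₂ (λ o r → (o ≡ᵇ j) ∧ q r) (occ-≡ m t) (erase-≡ m t)) (tuples N L)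
    head-≢ : ∀ a → a ≢ m → by-head a ≡ count (withOcc m j (q ∘ (a ∷_))) (tuples N L)
    head-≢ a a≢m = count-cong (λ t → cong₂ (λ o r → (o ≡ᵇ j) ∧ q r) (occ-≢ t a≢m) (erase-≢ t a≢m)) (tuples N L)

  count-withOcc-> : ∀ {j L} q → L < j → count (withOcc m j q) (tuples N L) ≡ 0
  count-withOcc-> {j} {L} q L<j = count-none (All.map too-many (tuples-isTuple N L))
    where
    too-many : ∀ {t} → IsTuple N L t → withOcc m j q t ≡ false
    too-many {t} (len , _) with occ m t ≡ᵇ j in occ≡j
    ... | false = refl
    ... | true  = ⊥-elim (<⇒≱ L<j (subst (_≤ L) (≡ᵇ⇒≡ _ _ (subst T (sym occ≡j) _))
                                                  (subst (occ m t ≤_) len (occ-≤-length m t))))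

  sum-zeroAt-avoiding : ∀ c (f : ℕ → ℕ) q k →
    (∀ a → a ≢ m → f a ≡ c * count (avoiding m (q ∘ (a ∷_))) (tuples N k)) →
    sum (map (zeroAt m f) (range1 N)) ≡ c * count (avoiding m q) (tuples N (suc k))
  sum-zeroAt-avoiding c f q k f≡ = begin
    sum (map (zeroAt m f) (range1 N))                ≡⟨ cong sum (map-cong (zeroAt-cong m f≡) (range1 N)) ⟩
    sum (map (zeroAt m (λ a → c * h a)) (range1 N))  ≡⟨ cong sum (map-cong (zeroAt-*ˡ m c h) (range1 N)) ⟩
    sum (map (λ a → c * zeroAt m h a) (range1 N))    ≡⟨ sum-map-*ˡ c (zeroAt m h) (range1 N) ⟩
    c * sum (map (zeroAt m h) (range1 N))            ≡⟨ cong (c *_) (count-avoiding-suc q k) ⟨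
    c * count (avoiding m q) (tuples N (suc k))      ∎
    where
    open ≡-Reasoning
    h : ℕ → ℕ
    h a = count (avoiding m (q ∘ (a ∷_))) (tuples N k)

  count-withOcc : ∀ L j k q → k + j ≡ L →
    count (withOcc m j q) (tuples N L) ≡ (L C j) * count (avoiding m q) (tuples N k)
  count-withOcc zero    zero    zero    q refl with q []
  ... | true  = refl
  ... | false = refl
  count-withOcc zero    zero    (suc k) q ()
  count-withOcc zero    (suc j) zero    q ()
  count-withOcc zero    (suc j) (suc k) q ()
  count-withOcc (suc L) zero    zero    q ()
  count-withOcc (suc L) zero    (suc k) q k+0≡L =
    trans (count-withOcc-suc 0 q L)
          (cong₂ _+_ (count-none (All.universal (λ _ → refl) (tuples N L)))
                     (sum-zeroAt-avoiding 1 _ q k (λ a _ → count-withOcc L 0 k _ (suc-injective k+0≡L))))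
  count-withOcc (suc .j) (suc j) zero    q refl = begin
    count (withOcc m (suc j) q) (tuples N (suc j))
      ≡⟨ count-withOcc-suc (suc j) q j ⟩
    count (withOcc m j q) (tuples N j) + _
      ≡⟨ cong₂ _+_ (count-withOcc j j zero q refl)
                   (sum-zeroAt-avoiding 0 _ q 0 (λ a _ → count-withOcc-> {suc j} {j} (q ∘ (a ∷_)) ≤-refl)) ⟩
    (j C j) * F + 0
      ≡⟨ +-identityʳ _ ⟩
    (j C j) * F
      ≡⟨ cong (_* F) (trans (nCn≡1 j) (sym (nCn≡1 (suc j)))) ⟩
    (suc j C suc j) * F
      ∎
    where
    open ≡-Reasoning
    F : ℕ
    F = count (avoiding m q) (tuples N 0)
  count-withOcc (suc L) (suc j) (suc k) q k+j≡L = begin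
    count (withOcc m (suc j) q) (tuples N (suc L))
      ≡⟨ count-withOcc-suc (suc j) q L ⟩
    count (withOcc m j q) (tuples N L) + _
      ≡⟨ cong₂ _+_ (count-withOcc L j (suc k) q (trans (sym (+-suc k j)) (suc-injective k+j≡L)))
                   (sum-zeroAt-avoiding (L C suc j) _ q k (λ a _ → count-withOcc L (suc j) k _ (suc-injective k+j≡L))) ⟩
    (L C j) * F + (L C suc j) * F
      ≡⟨ *-distribʳ-+ F (L C j) (L C suc j) ⟨
    (L C j + L C suc j) * F
      ≡⟨ cong (_* F) (nCk+nC[k+1]≡[n+1]C[k+1] L j) ⟩
    (suc L C suc j) * F
      ∎
    where
    open ≡-Reasoning
    F : ℕ
    F = count (avoiding m q) (tuples N (suc k))

countLess-∷-< : ∀ {x y} t → y < x → countLess x (y ∷ t) ≡ suc (countLess x t)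
countLess-∷-< {x} t y<x = cong length (filter-accept (_<? x) y<x)

countLess-∷-≮ : ∀ {x y} t → ¬ y < x → countLess x (y ∷ t) ≡ countLess x t
countLess-∷-≮ {x} t y≮x = cong length (filter-reject (_<? x) y≮x)

countLess-erase : ∀ {x m} t → x ≤ m → countLess x (erase m t) ≡ countLess x t
countLess-erase         []      x≤m = refl
countLess-erase {x} {m} (y ∷ t) x≤m with y ≟ m
... | yes refl = trans (countLess-erase t x≤m) (sym (countLess-∷-≮ t (≤⇒≯ x≤m)))
... | no  _ with y <? x
...   | yes y<x = trans (countLess-∷-< (erase m t) y<x) (trans (cong suc (countLess-erase t x≤m)) (sym (countLess-∷-< t y<x)))
...   | no  y≮x = trans (countLess-∷-≮ (erase m t) y≮x) (trans (countLess-erase t x≤m) (sym (countLess-∷-≮ t y≮x)))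

countLess-all< : ∀ {x t} → All (_< x) t → countLess x t ≡ length t
countLess-all< {t = []}    []           = refl
countLess-all< {t = y ∷ t} (y<x ∷ t<x) = trans (countLess-∷-< t y<x) (cong suc (countLess-all< t<x))

countLess-suc : ∀ v t → countLess (suc v) t ≡ countLess v t + occ v t
countLess-suc v []      = refl
countLess-suc v (y ∷ t) with y ≟ v
... | yes refl = begin
  countLess (suc y) (y ∷ t)         ≡⟨ countLess-∷-< t ≤-refl ⟩
  suc (countLess (suc y) t)         ≡⟨ cong suc (countLess-suc y t) ⟩
  suc (countLess y t + occ y t)     ≡⟨ +-suc _ _ ⟨
  countLess y t + suc (occ y t)     ≡⟨ cong (_+ suc (occ y t)) (countLess-∷-≮ t (<-irrefl refl)) ⟨
  countLess y (y ∷ t) + suc (occ y t) ∎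
  where open ≡-Reasoning
... | no y≢v with y <? v
...   | yes y<v = trans (countLess-∷-< t (m≤n⇒m≤1+n y<v))
                        (trans (cong suc (countLess-suc v t)) (cong (_+ occ v t) (sym (countLess-∷-< t y<v))))
...   | no  y≮v = trans (countLess-∷-≮ t (λ y<1+v → y≮v (≤∧≢⇒< (≤-pred y<1+v) y≢v)))
                        (trans (countLess-suc v t) (cong (_+ occ v t) (sym (countLess-∷-≮ t y≮v))))

countLess+occ≤length : ∀ v t → countLess v t + occ v t ≤ length t
countLess+occ≤length v t = ≤-trans (≤-reflexive (sym (countLess-suc v t))) (length-filter (_<? suc v) t)

Fubini-bounded : ∀ {r} → IsFubiniRanking r → All (_≤ length r) r
Fubini-bounded {r} fub = All.zipWith bound (fub , All.tabulate occ-∈)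
  where
  bound : ∀ {x} → x ≡ suc (countLess x r) × 1 ≤ occ x r → x ≤ length r
  bound {x} (x≡ , 1≤occ) = begin
    x                       ≡⟨ trans x≡ (+-comm 1 _) ⟩
    countLess x r + 1       ≤⟨ +-monoʳ-≤ (countLess x r) 1≤occ ⟩
    countLess x r + occ x r ≤⟨ countLess+occ≤length x r ⟩
    length r                ∎
    where open ≤-Reasoning

Fubini-double-gap : ∀ {t v} → IsFubiniRanking t → occ v t ≡ 2 → occ (suc v) t ≡ 0
Fubini-double-gap {t} {v} fub occ≡2 with occ (suc v) t in occ-next
... | zero  = refl
... | suc _ = ⊥-elim (1+n≢n (trans (sym (+-comm c 2)) (trans (sym v≡c+2) v≡1+c)))
  where
  c : ℕ
  c = countLess v t
  v≡1+c : v ≡ suc c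
  v≡1+c = All-occ v t fub (subst (1 ≤_) (sym occ≡2) (s≤s z≤n))
  v≡c+2 : v ≡ c + 2
  v≡c+2 = suc-injective (trans (All-occ (suc v) t fub (subst (1 ≤_) (sym occ-next) (s≤s z≤n)))
                               (cong suc (trans (countLess-suc v t) (cong (c +_) occ≡2))))

Fubini-double-room : ∀ {t v} → IsFubiniRanking t → occ v t ≡ 2 → suc v ≤ length t
Fubini-double-room {t} {v} fub occ≡2 = begin
  suc v                   ≡⟨ cong suc (All-occ v t fub (subst (1 ≤_) (sym occ≡2) (s≤s z≤n))) ⟩
  2 + countLess v t       ≡⟨ +-comm 2 _ ⟩
  countLess v t + 2       ≡⟨ cong (countLess v t +_) occ≡2 ⟨
  countLess v t + occ v t ≤⟨ countLess+occ≤length v t ⟩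
  length t                ∎
  where open ≤-Reasoning

AtMostTwice : List ℕ → Set
AtMostTwice t = ∀ v → occ v t ≤ 2

SmallBlockFubini : ℕ → List ℕ → Set
SmallBlockFubini L t = IsFubiniRanking t × AtMostTwice t × length t ≡ L

TopBlock : ℕ → ℕ → List ℕ → Set
TopBlock j L t = occ (suc L) t ≡ j × SmallBlockFubini L (erase (suc L) t)

addTopBlock : ∀ {j L} t → j ≤ 2 → TopBlock j L t → SmallBlockFubini (j + L) t
addTopBlock {j} {L} t j≤2 (occ≡j , fub-u , twice-u , len-u) =
  All-erase⁻ m t m≡ (All.zipWith extend (fub-u , u<m)) , twice , trans (length-erase m t) (cong₂ _+_ occ≡j len-u)
  where
  m : ℕ
  m = suc L
  u : List ℕ
  u = erase m t
  u<m : All (_< m) u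
  u<m = All.map s≤s (subst (λ n → All (_≤ n) u) len-u (Fubini-bounded fub-u))
  m≡ : m ≡ suc (countLess m t)
  m≡ = cong suc (trans (sym len-u) (trans (sym (countLess-all< u<m)) (countLess-erase t ≤-refl)))
  extend : ∀ {x} → x ≡ suc (countLess x u) × x < m → x ≡ suc (countLess x t)
  extend (x≡ , x<m) = trans x≡ (cong suc (countLess-erase t (<⇒≤ x<m)))
  twice : AtMostTwice t
  twice v with v ≟ m
  ... | yes refl = subst (_≤ 2) (sym occ≡j) j≤2
  ... | no  v≢m  = subst (_≤ 2) (occ-erase-≢ t v≢m) (twice-u v)

eraseMax : ∀ {M} t → IsFubiniRanking t → All (_≤ M) t → 1 ≤ occ M t →
           IsFubiniRanking (erase M t) × M ≡ suc (length (erase M t))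
eraseMax {M} t fub t≤M 1≤occ = All.zipWith restrict (All-erase⁺ M fub , u<M) , M≡
  where
  u : List ℕ
  u = erase M t
  u<M : All (_< M) u
  u<M = erase-max M t≤M
  restrict : ∀ {x} → x ≡ suc (countLess x t) × x < M → x ≡ suc (countLess x u)
  restrict (x≡ , x<M) = trans x≡ (cong suc (sym (countLess-erase t (<⇒≤ x<M))))
  M≡ : M ≡ suc (length u)
  M≡ = trans (All-occ M t fub 1≤occ) (cong suc (trans (sym (countLess-erase t ≤-refl)) (countLess-all< u<M)))

topBlock : ∀ {L} t → SmallBlockFubini (suc L) t →
           Σ[ j ∈ ℕ ] Σ[ n ∈ ℕ ] suc L ≡ j + n × 1 ≤ j × j ≤ 2 × TopBlock j n t
topBlock {L} (x ∷ t) (fub , twice , len) =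
  occ M (x ∷ t) , length u , trans (sym len) (length-erase M (x ∷ t)) , 1≤occ , twice M ,
  atTop (proj₂ erased) (proj₁ erased , (λ v → ≤-trans (occ-erase-≤ v M (x ∷ t)) (twice v)) , refl)
  where
  M : ℕ
  M = max x t
  u : List ℕ
  u = erase M (x ∷ t)
  1≤occ : 1 ≤ occ M (x ∷ t)
  1≤occ = argmax-all id {P = λ y → 1 ≤ occ y (x ∷ t)} {x} {t} (occ-∈ {x} {x ∷ t} (here refl))
                     (All.tabulate λ {y} y∈t → occ-∈ {y} {x ∷ t} (there y∈t))
  erased : IsFubiniRanking u × M ≡ suc (length u)
  erased = eraseMax (x ∷ t) fub (⊥≤max x t ∷ xs≤max x t) 1≤occ
  atTop : ∀ {M n} → M ≡ suc n → SmallBlockFubini n (erase M (x ∷ t)) → TopBlock (occ M (x ∷ t)) n (x ∷ t)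
  atTop refl sbf = refl , sbf

topBlock-1 : ∀ t → SmallBlockFubini 1 t → TopBlock 1 0 t
topBlock-1 t sbf with topBlock t sbf
... | 1 , 0 , refl , _ , _ , top = top
... | suc (suc j) , n , () , _

topBlock-2+ : ∀ {L} t → SmallBlockFubini (suc (suc L)) t → TopBlock 1 (suc L) t ⊎ TopBlock 2 L t
topBlock-2+ t sbf with topBlock t sbf
... | 1 , _ , refl , _ , _ , top = inj₁ top
... | 2 , _ , refl , _ , _ , top = inj₂ top
... | suc (suc (suc j)) , _ , _ , _ , s≤s (s≤s ()) , _

-- A top block of size j of a ranking of length L has the value L + 1 - j.
unitFubiniᵇ : ℕ → List ℕ → Bool
unitFubiniᵇ zero            = null
unitFubiniᵇ (suc zero)      = withOcc 1 1 (unitFubiniᵇ 0)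
unitFubiniᵇ (suc (suc L)) t = withOcc (suc (suc L)) 1 (unitFubiniᵇ (suc L)) t ∨ withOcc (suc L) 2 (unitFubiniᵇ L) t

withOcc-sound : ∀ {m j} {q : List ℕ → Bool} {P : List ℕ → Set} t →
                (∀ u → T (q u) → P u) → T (withOcc m j q t) → occ m t ≡ j × P (erase m t)
withOcc-sound {m} {j} t q⇒P h = let occ≡j , qu = Equivalence.to T-∧ h in ≡ᵇ⇒≡ (occ m t) j occ≡j , q⇒P _ qu

withOcc-complete : ∀ {m j} {q : List ℕ → Bool} {P : List ℕ → Set} t →
                   (∀ u → P u → T (q u)) → occ m t ≡ j × P (erase m t) → T (withOcc m j q t)
withOcc-complete {m} {j} t P⇒q (occ≡j , pu) = Equivalence.from T-∧ (≡⇒≡ᵇ (occ m t) j occ≡j , P⇒q _ pu)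

unitFubiniᵇ-sound : ∀ L t → T (unitFubiniᵇ L t) → SmallBlockFubini L t
unitFubiniᵇ-sound zero          []      _ = [] , (λ _ → z≤n) , refl
unitFubiniᵇ-sound zero          (_ ∷ _) ()
unitFubiniᵇ-sound (suc zero)    t       h =
  addTopBlock t (s≤s z≤n) (withOcc-sound t (unitFubiniᵇ-sound zero) h)
unitFubiniᵇ-sound (suc (suc L)) t       h =
  [ (λ h₁ → addTopBlock t (s≤s z≤n) (withOcc-sound t (unitFubiniᵇ-sound (suc L)) h₁))
  , (λ h₂ → addTopBlock t ≤-refl (withOcc-sound t (unitFubiniᵇ-sound L) h₂))
  ] (Equivalence.to T-∨ h)

unitFubiniᵇ-complete : ∀ L t → SmallBlockFubini L t → T (unitFubiniᵇ L t)
unitFubiniᵇ-complete zero          []      _ = _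
unitFubiniᵇ-complete zero          (_ ∷ _) (_ , _ , ())
unitFubiniᵇ-complete (suc zero)    t       h = withOcc-complete t (unitFubiniᵇ-complete zero) (topBlock-1 t h)
unitFubiniᵇ-complete (suc (suc L)) t       h = Equivalence.from T-∨
  (Sum.map (withOcc-complete t (unitFubiniᵇ-complete (suc L))) (withOcc-complete t (unitFubiniᵇ-complete L))
           (topBlock-2+ t h))

unitFubiniᵇ-bounded : ∀ {L} t → T (unitFubiniᵇ L t) → All (_≤ L) t
unitFubiniᵇ-bounded {L} t h =
  let fub , _ , len = unitFubiniᵇ-sound L t h in subst (λ n → All (_≤ n) t) len (Fubini-bounded fub)

unitFubiniCount : ℕ → ℕ
unitFubiniCount n = count (unitFubiniᵇ n) (tuples n n)

avoiding-redundant : ∀ {m} (q : List ℕ → Bool) t → (T (q t) → occ m t ≡ 0) → avoiding m q t ≡ q t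
avoiding-redundant {m} q t q⇒occ≡0 with q t
... | false = ∧-zeroʳ _
... | true  rewrite q⇒occ≡0 _ = refl

count-withOcc-unitFubiniᵇ : ∀ {L m N} j → L < m → m ≤ N → L + j ≡ N →
  count (withOcc m j (unitFubiniᵇ L)) (tuples N N) ≡ (N C j) * unitFubiniCount L
count-withOcc-unitFubiniᵇ {L} {m} {N} j L<m m≤N L+j≡N = begin
  count (withOcc m j q) (tuples N N)
    ≡⟨ Positions.count-withOcc m N (≤-trans (s≤s z≤n) L<m , m≤N) N j L q L+j≡N ⟩
  (N C j) * count (avoiding m q) (tuples N L)
    ≡⟨ cong ((N C j) *_) (count-cong (λ t → avoiding-redundant q t (below-m t)) (tuples N L)) ⟩
  (N C j) * count q (tuples N L)
    ≡⟨ cong ((N C j) *_) (count-tuples-bounded q (≤-trans (<⇒≤ L<m) m≤N) unitFubiniᵇ-bounded L) ⟩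
  (N C j) * count q (tuples L L)
    ∎
  where
  open ≡-Reasoning
  q : List ℕ → Bool
  q = unitFubiniᵇ L
  below-m : ∀ t → T (q t) → occ m t ≡ 0
  below-m t qt = occ-> m t (unitFubiniᵇ-bounded t qt) L<m

unitFubiniCount-rec : ∀ L → unitFubiniCount (suc (suc L))
  ≡ suc (suc L) * unitFubiniCount (suc L) + (suc (suc L) C 2) * unitFubiniCount L
unitFubiniCount-rec L = begin
  unitFubiniCount (suc (suc L))
    ≡⟨ count-∨ single double disjoint (tuples (suc (suc L)) (suc (suc L))) ⟩
  count single (tuples (suc (suc L)) (suc (suc L))) + count double (tuples (suc (suc L)) (suc (suc L)))
    ≡⟨ cong₂ _+_ (count-withOcc-unitFubiniᵇ 1 ≤-refl ≤-refl (+-comm (suc L) 1))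
                 (count-withOcc-unitFubiniᵇ 2 ≤-refl (n≤1+n _) (+-comm L 2)) ⟩
  (suc (suc L) C 1) * unitFubiniCount (suc L) + (suc (suc L) C 2) * unitFubiniCount L
    ≡⟨ cong (λ c → c * unitFubiniCount (suc L) + (suc (suc L) C 2) * unitFubiniCount L) (nC1≡n (suc (suc L))) ⟩
  suc (suc L) * unitFubiniCount (suc L) + (suc (suc L) C 2) * unitFubiniCount L
    ∎
  where
  open ≡-Reasoning
  single double : List ℕ → Bool
  single = withOcc (suc (suc L)) 1 (unitFubiniᵇ (suc L))
  double = withOcc (suc L) 2 (unitFubiniᵇ L)
  disjoint : ∀ t → T (single t) → T (double t) → ⊥
  disjoint t s d = 1+n≢0 (begin
    1                                       ≡⟨ proj₁ (withOcc-sound t (unitFubiniᵇ-bounded {suc L}) s) ⟨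
    occ (suc (suc L)) t                     ≡⟨ occ-erase-≢ t (λ ()) ⟨
    occ (suc (suc L)) (erase (suc L) t)     ≡⟨ occ-> _ _ (proj₂ (withOcc-sound t unitFubiniᵇ-bounded d)) (n≤1+n _) ⟩
    0                                       ∎)

firstFree-∉ : ∀ {n O a s} fuel → firstFree n O a fuel ≡ just s → s ∉ O
firstFree-∉ {n} {O} {a} (suc fuel) found with a ≤? n
... | yes _ with a ∈? O
...   | yes _ = firstFree-∉ fuel found
firstFree-∉ {n} {O} {a} (suc fuel) refl | yes _ | no a∉O = a∉O

parkFrom-spots : ∀ {n} O as ss → parkFrom n O as ≡ just ss →
                 length ss ≡ length as × (∀ w → occ w ss ≤ 1) × (∀ {w} → w ∈ O → occ w ss ≡ 0)
parkFrom-spots O [] .[] refl = refl , (λ _ → z≤n) , (λ _ → refl)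
parkFrom-spots {n} O (a ∷ as) ss parked with firstFree n O a n in found
... | just s with parkFrom n (s ∷ O) as in rest
parkFrom-spots {n} O (a ∷ as) .(s ∷ ss) refl | just s | just ss
  with parkFrom-spots (s ∷ O) as ss rest
... | len , once , fresh = cong suc len , once′ , fresh′
  where
  once′ : ∀ w → occ w (s ∷ ss) ≤ 1
  once′ w with s ≟ w
  ... | yes refl = s≤s (≤-reflexive (fresh (here refl)))
  ... | no  _    = once w
  fresh′ : ∀ {w} → w ∈ O → occ w (s ∷ ss) ≡ 0
  fresh′ {w} w∈O with s ≟ w
  ... | yes refl = ⊥-elim (firstFree-∉ n found w∈O)
  ... | no  _    = fresh (there w∈O)

occ-≤-parksNear : ∀ t s → length s ≡ length t → All ParksNear (zip t s) →
                  ∀ v → occ v t ≤ occ v s + occ (suc v) s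
occ-≤-parksNear []      s        _   _          v = z≤n
occ-≤-parksNear (x ∷ t) (y ∷ s)  len (near ∷ h) v with x ≟ v
... | no  _ = ≤-trans (occ-≤-parksNear t s (suc-injective len) h v)
                      (+-mono-≤ (occ-≤-occ-∷ v y s) (occ-≤-occ-∷ (suc v) y s))
occ-≤-parksNear (x ∷ t) (.x ∷ s) len (inj₁ refl ∷ h) .x | yes refl
  rewrite occ-≡ x s | occ-≢ {suc x} s (λ x≡1+x → <-irrefl x≡1+x (n<1+n x)) =
    s≤s (occ-≤-parksNear t s (suc-injective len) h x)
occ-≤-parksNear (x ∷ t) (.(suc x) ∷ s) len (inj₂ refl ∷ h) .x | yes refl
  rewrite occ-≡ (suc x) s | occ-≢ {x} s (λ 1+x≡x → <-irrefl (sym 1+x≡x) (n<1+n x)) | +-suc (occ x s) (occ (suc x) s) =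
    s≤s (occ-≤-parksNear t s (suc-injective len) h x)

unitIntervalPF⇒atMostTwice : ∀ {n} t → IsUnitIntervalPF n t → AtMostTwice t
unitIntervalPF⇒atMostTwice t (s , parked , near) v =
  let len , once , _ = parkFrom-spots [] t s parked
  in ≤-trans (occ-≤-parksNear t s len near v) (+-mono-≤ (once v) (once (suc v)))

parkFrom-∷ : ∀ {n O a q s ss} → firstFree n O a n ≡ just s → parkFrom n (s ∷ O) q ≡ just ss →
             parkFrom n O (a ∷ q) ≡ just (s ∷ ss)
parkFrom-∷ found parked rewrite found | parked = refl

firstFree-free : ∀ {n O a fuel} → 1 ≤ fuel → a ≤ n → a ∉ O → firstFree n O a fuel ≡ just a
firstFree-free {n} {O} {a} {suc fuel} _ a≤n a∉O with a ≤? n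
... | no  a≰n = ⊥-elim (a≰n a≤n)
... | yes _ with a ∈? O
...   | yes a∈O = ⊥-elim (a∉O a∈O)
...   | no  _   = refl

firstFree-next : ∀ {n O a fuel} → 2 ≤ fuel → a ≤ n → a ∈ O → suc a ≤ n → suc a ∉ O →
                 firstFree n O a fuel ≡ just (suc a)
firstFree-next {n} {O} {a} {suc fuel} (s≤s 1≤fuel) a≤n a∈O 1+a≤n 1+a∉O with a ≤? n
... | no  a≰n = ⊥-elim (a≰n a≤n)
... | yes _ with a ∈? O
...   | yes _   = firstFree-free 1≤fuel 1+a≤n 1+a∉O
...   | no  a∉O = ⊥-elim (a∉O a∈O)

occ-move : ∀ x a p q → occ x (a ∷ p) + occ x q ≡ occ x p + occ x (a ∷ q)
occ-move x a p q with a ≟ x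
... | yes _ = sym (+-suc _ _)
... | no  _ = refl

module Simulation (n : ℕ) (C : ℕ → ℕ) (C≤2 : ∀ x → C x ≤ 2)
                  (gap : ∀ x → C x ≡ 2 → C (suc x) ≡ 0) (room : ∀ x → C x ≡ 2 → suc x ≤ n) where

  record Splits (p q : List ℕ) : Set where
    constructor splits
    field split : ∀ x → occ x p + occ x q ≡ C x
  open Splits

  -- O is the list of occupied spots once the cars with preferences p have parked.
  record Occupancy (O p : List ℕ) : Set where
    field
      occupied⇒ : ∀ {x} → x ∈ O → 1 ≤ occ x p ⊎ Σ[ v ∈ ℕ ] x ≡ suc v × 2 ≤ occ v p
      ⇒occupied : ∀ {x} → 1 ≤ occ x p → x ∈ O
  open Occupancy

  Splits-move : ∀ {p q a} → Splits p (a ∷ q) → Splits (a ∷ p) q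
  Splits-move {p} {q} {a} sp = splits λ x → trans (occ-move x a p q) (split sp x)

  occ≤C : ∀ {p q} → Splits p q → ∀ x → occ x p ≤ C x
  occ≤C sp x = subst (_ ≤_) (split sp x) (m≤m+n _ _)

  next≤C : ∀ {p q a} → Splits p (a ∷ q) → suc (occ a p) ≤ C a
  next≤C {p} {q} {a} sp = subst (suc (occ a p) ≤_) (split sp a) (begin
    suc (occ a p)                   ≤⟨ s≤s (m≤m+n _ (occ a q)) ⟩
    suc (occ a p + occ a q)         ≡⟨ +-suc _ _ ⟨
    occ a p + suc (occ a q)         ≡⟨ cong (occ a p +_) (occ-≡ a q) ⟨
    occ a p + occ a (a ∷ q)         ∎)
    where open ≤-Reasoning

  occupied⇒-∷ : ∀ {O p} a → Occupancy O p →
                ∀ {x} → x ∈ O → 1 ≤ occ x (a ∷ p) ⊎ Σ[ v ∈ ℕ ] x ≡ suc v × 2 ≤ occ v (a ∷ p)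
  occupied⇒-∷ {p = p} a occu x∈O =
    Sum.map (λ h → ≤-trans h (occ-≤-occ-∷ _ a p)) (λ (v , x≡ , h) → v , x≡ , ≤-trans h (occ-≤-occ-∷ v a p))
            (occupied⇒ occu x∈O)

  ⇒occupied-∷ : ∀ {O p a s} → Occupancy O p → a ∈ s ∷ O → ∀ {x} → 1 ≤ occ x (a ∷ p) → x ∈ s ∷ O
  ⇒occupied-∷ {a = a} occu a∈ {x} h with a ≟ x
  ... | yes refl = a∈
  ... | no  _    = there (⇒occupied occu h)

  ParksAt : List ℕ → List ℕ → ℕ → Set
  ParksAt O p a = Σ[ s ∈ ℕ ] firstFree n O a n ≡ just s × ParksNear (a , s) × Occupancy (s ∷ O) (a ∷ p)

  first-occurrence : ∀ {O p q a} → Splits p (a ∷ q) → Occupancy O p → InRange n a → occ a p ≡ 0 → ParksAt O p a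
  first-occurrence {O} {p} {q} {a} sp occu (1≤a , a≤n) occ≡0 =
    a , firstFree-free (≤-trans 1≤a a≤n) a≤n a∉O , inj₁ refl ,
    record { occupied⇒ = occupied ; ⇒occupied = ⇒occupied-∷ occu (here refl) }
    where
    a∉O : a ∉ O
    a∉O a∈O with occupied⇒ occu a∈O
    ... | inj₁ 1≤occ = case subst (1 ≤_) occ≡0 1≤occ of λ ()
    ... | inj₂ (v , refl , 2≤occ) =
      case subst (1 ≤_) (gap v (≤-antisym (C≤2 v) (≤-trans 2≤occ (occ≤C sp v)))) (≤-trans (s≤s z≤n) (next≤C sp)) of λ ()
    occupied : ∀ {x} → x ∈ a ∷ O → 1 ≤ occ x (a ∷ p) ⊎ Σ[ v ∈ ℕ ] x ≡ suc v × 2 ≤ occ v (a ∷ p)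
    occupied (here refl) = inj₁ (subst (1 ≤_) (sym (occ-≡ a p)) (s≤s z≤n))
    occupied (there x∈O) = occupied⇒-∷ a occu x∈O

  second-occurrence : ∀ {O p q a} → Splits p (a ∷ q) → Occupancy O p → InRange n a → occ a p ≡ 1 → ParksAt O p a
  second-occurrence {O} {p} {q} {a} sp occu (1≤a , a≤n) occ≡1 =
    suc a , firstFree-next (≤-trans (s≤s 1≤a) (room a Ca≡2)) a≤n a∈O (room a Ca≡2) 1+a∉O , inj₂ refl ,
    record { occupied⇒ = occupied ; ⇒occupied = ⇒occupied-∷ occu (there a∈O) }
    where
    a∈O : a ∈ O
    a∈O = ⇒occupied occu (≤-reflexive (sym occ≡1))
    Ca≡2 : C a ≡ 2
    Ca≡2 = ≤-antisym (C≤2 a) (subst (λ k → suc k ≤ C a) occ≡1 (next≤C sp))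
    1+a∉O : suc a ∉ O
    1+a∉O 1+a∈O with occupied⇒ occu 1+a∈O
    ... | inj₁ 1≤occ = case subst (1 ≤_) (gap a Ca≡2) (≤-trans 1≤occ (occ≤C sp (suc a))) of λ ()
    ... | inj₂ (v , refl , 2≤occ) = case subst (2 ≤_) occ≡1 2≤occ of λ { (s≤s ()) }
    occupied : ∀ {x} → x ∈ suc a ∷ O → 1 ≤ occ x (a ∷ p) ⊎ Σ[ v ∈ ℕ ] x ≡ suc v × 2 ≤ occ v (a ∷ p)
    occupied (here refl) = inj₂ (a , refl , subst (2 ≤_) (sym (trans (occ-≡ a p) (cong suc occ≡1))) ≤-refl)
    occupied (there x∈O) = occupied⇒-∷ a occu x∈O

  step : ∀ {O p q a} → Splits p (a ∷ q) → Occupancy O p → InRange n a → ParksAt O p a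
  step {O} {p} {q} {a} sp occu a∈[n] with occ a p in occ-a
  ... | 0           = first-occurrence sp occu a∈[n] occ-a
  ... | 1           = second-occurrence sp occu a∈[n] occ-a
  ... | suc (suc k) = case ≤-trans (subst (λ j → suc j ≤ C a) occ-a (next≤C sp)) (C≤2 a) of λ { (s≤s (s≤s ())) }

  park : ∀ q {p O} → Splits p q → Occupancy O p → All (InRange n) q →
         Σ[ s ∈ List ℕ ] parkFrom n O q ≡ just s × All ParksNear (zip q s)
  park []      _     _    _                  = [] , refl , []
  park (a ∷ q) {p} {O} sp occu (a∈[n] ∷ q∈[n]) with step sp occu a∈[n]
  ... | s , found , near , occu′ with park q (Splits-move sp) occu′ q∈[n]
  ...   | ss , parked , nears = s ∷ ss , parkFrom-∷ {n} {O} {a} {q} found parked , near ∷ nears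

fubini⇒unitIntervalPF : ∀ {n} t → IsFubiniRanking t → AtMostTwice t → length t ≡ n → All (InRange n) t →
                        IsUnitIntervalPF n t
fubini⇒unitIntervalPF {n} t fub twice len t∈[n] =
  Simulation.park n (λ x → occ x t) twice (λ _ → Fubini-double-gap fub)
                  (λ _ occ≡2 → subst (_ ≤_) len (Fubini-double-room fub occ≡2))
                  t {[]} {[]} (Simulation.splits λ _ → refl) (record { occupied⇒ = λ () ; ⇒occupied = λ () }) t∈[n]

length-filter-count : ∀ {A : Set} {P : A → Set} (P? : Decidable P) (p : A → Bool) {xs} →
                      All (λ x → P x ⇔ T (p x)) xs → length (filter P? xs) ≡ count p xs
length-filter-count P? p {[]}     []           = refl
length-filter-count P? p {x ∷ xs} (Px⇔px ∷ h) with P? x | p x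
... | yes _   | true  = cong suc (length-filter-count P? p h)
... | yes Px  | false = ⊥-elim (Equivalence.to Px⇔px Px)
... | no  ¬Px | true  = ⊥-elim (¬Px (Equivalence.from Px⇔px _))
... | no  _   | false = length-filter-count P? p h

isUnitFubini⇔unitFubiniᵇ : ∀ {n t} → IsTuple n n t → IsUnitFubini n t ⇔ T (unitFubiniᵇ n t)
isUnitFubini⇔unitFubiniᵇ {n} {t} (len , t∈[n]) = mk⇔
  (λ (fub , pf) → unitFubiniᵇ-complete n t (fub , unitIntervalPF⇒atMostTwice t pf , len))
  (λ h → let fub , twice , _ = unitFubiniᵇ-sound n t h in fub , fubini⇒unitIntervalPF t fub twice len t∈[n])

g≡unitFubiniCount : ∀ n → g n ≡ unitFubiniCount n
g≡unitFubiniCount n = length-filter-count (isUnitFubini? n) (unitFubiniᵇ n)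
                        (All.map isUnitFubini⇔unitFubiniᵇ (tuples-isTuple n n))

theorem5p2 : (g 1 ≡ 1) × (g 2 ≡ 3)
    × (∀ (n : ℕ) → 2 ≤ n → g (suc n) ≡ suc n * g n + (suc n C 2) * g (n ∸ 1))
theorem5p2 = refl , refl , recurrence
  where
  recurrence : ∀ n → 2 ≤ n → g (suc n) ≡ suc n * g n + (suc n C 2) * g (n ∸ 1)
  recurrence (suc L) _ = begin
    g (suc (suc L))
      ≡⟨ g≡unitFubiniCount (suc (suc L)) ⟩
    unitFubiniCount (suc (suc L))
      ≡⟨ unitFubiniCount-rec L ⟩
    suc (suc L) * unitFubiniCount (suc L) + (suc (suc L) C 2) * unitFubiniCount L
      ≡⟨ cong₂ (λ a b → suc (suc L) * a + (suc (suc L) C 2) * b) (g≡unitFubiniCount (suc L)) (g≡unitFubiniCount L) ⟨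
    suc (suc L) * g (suc L) + (suc (suc L) C 2) * g L
      ∎
    where open ≡-Reasoning
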